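{- Let $\lambda$ be an odd positive integer and $k$ a positive integer, and suppose there is a $k$-MOFS$(2\lambda)$ with a full relation $(X_1,\dots,X_{k+2})$. If $k\equiv 1\pmod 8$ then $|X_1||X_2|\equiv 1\pmod 4$, and if $k\equiv 5\pmod 8$ then $|X_1||X_2|\equiv 3\pmod 4$.
   Context: Let $N(n)=\{1,\dots,n\}$ and let $n$ be even. A (binary) frequency square of order $n$ is an $n\times n$ array indexed by $N(n)\times N(n)$ with entries in $\{0,1\}$ such that every row and every column contains exactly $n/2$ zeros and $n/2$ ones. Two frequency squares $F,G$ of order $n$ are orthogonal if for each $(a,b)\in\{0,1\}^2$ the number of cells $(r,c)$ with $(F[r,c],G[r,c])=(a,b)$ equals $n^2/4$. A $k$-MOFS$(n)$ is an ordered set $F_1,\dots,F_k$ of pairwise orthogonal frequency squares of order $n$. Relations: form the $n^2\times(k+2)$ array $\mathcal O$ having a row $(i,j,F_1[i,j],\dots,F_k[i,j])$ for each $(i,j)\in N(n)^2$. Let $Y_1=Y_2=N(n)$ and $Y_c=\{0,1\}$ for $3\le c\le k+2$. A relation is a tuple $(X_1,\dots,X_{k+2})$ with $X_c\subseteq Y_c$ for all $c$ such that every row of $\mathcal O$ has an even number of positions $c$ for which the $c$-th entry of the row lies in $X_c$. A relation is trivial on column $c$ if $X_c=\emptyset$ or $X_c=Y_c$; it is full if it is non-trivial on every column $c\in\{1,\dots,k+2\}$ except possibly one of the columns $1,2$. -}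

module Defs where

open import Data.Nat using (ℕ; zero; suc; _+_; _*_)
open import Data.Bool using (Bool; true; false; not; if_then_else_; _xor_; _∧_)
open import Data.Fin using (Fin; zero; suc)
open import Data.Product using (_×_; ∃₂; ∃)
open import Data.Sum using (_⊎_)
open import Relation.Binary.PropositionalEquality using (_≡_; _≢_)

sumFin : {n : ℕ} → (Fin n → ℕ) → ℕ
sumFin {zero}  f = 0
sumFin {suc n} f = f zero + sumFin {n} (λ i → f (suc i))

toℕ : Bool → ℕ
toℕ false = 0
toℕ true  = 1

count : {n : ℕ} → (Fin n → Bool) → ℕ
count p = sumFin (λ i → toℕ (p i))

count2 : {n : ℕ} → (Fin n → Fin n → Bool) → ℕ
count2 p = sumFin (λ i → count (p i))

-- Conventions: N(n) is Fin n; {0,1} is Bool with false = 0, true = 1.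
-- A binary n×n array.
Square : ℕ → Set
Square n = Fin n → Fin n → Bool

IsFreqSquare : (h : ℕ) → Square (h + h) → Set
IsFreqSquare h F =
  ((r : Fin (h + h)) → (count (λ c → F r c) ≡ h) × (count (λ c → not (F r c)) ≡ h)) ×
  ((c : Fin (h + h)) → (count (λ r → F r c) ≡ h) × (count (λ r → not (F r c)) ≡ h))

_==_ : Bool → Bool → Bool
a == b = not (a xor b)

-- Orthogonality of squares of order n = h + h: each pair (a,b) occurs
-- exactly n²/4 = h*h times.
Orthogonal : (h : ℕ) → Square (h + h) → Square (h + h) → Set
Orthogonal h F G = (a b : Bool) →
  count2 (λ r c → (F r c == a) ∧ (G r c == b)) ≡ h * h

IsMOFS : (h k : ℕ) → (Fin k → Square (h + h)) → Set
IsMOFS h k F = ((s : Fin k) → IsFreqSquare h (F s)) ×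
               ((s t : Fin k) → s ≢ t → Orthogonal h (F s) (F t))

-- A relation (X₁, X₂, X₃, …, X_{k+2}): X₁, X₂ ⊆ N(n) given as characteristic
-- functions, and the columns 3..k+2 given by Xs : Fin k → (Bool → Bool)
-- (Xs s is the characteristic function of X_{s+3} ⊆ {0,1}).
-- Condition: for every row (i,j,F₁[i,j],…,F_k[i,j]) of the orthogonal array,
-- the number of positions whose entry lies in the corresponding X is even.
Even : ℕ → Set
Even m = ∃ λ q → m ≡ q + q

IsRelation : {n k : ℕ} → (Fin k → Square n) →
             (Fin n → Bool) → (Fin n → Bool) → (Fin k → Bool → Bool) → Set
IsRelation F X₁ X₂ Xs = (i j : Fin _) →
  Even (toℕ (X₁ i) + toℕ (X₂ j) + sumFin (λ s → toℕ (Xs s (F s i j))))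

NonTrivial : {A : Set} → (A → Bool) → Set
NonTrivial X = ∃₂ λ a b → (X a ≡ true) × (X b ≡ false)

IsFull : {n k : ℕ} → (Fin n → Bool) → (Fin n → Bool) → (Fin k → Bool → Bool) → Set
IsFull X₁ X₂ Xs = (NonTrivial X₁ ⊎ NonTrivial X₂) × ((s : Fin _) → NonTrivial (Xs s))

-- Let w(i,j) be the number of squares with a one in cell (i,j), and t(i,j) = [i ∈ X₁] + [j ∈ X₂] + c,
-- where c is the number of columns s with 0 ∈ X_{s+3}.  A non-trivial subset of {0,1} is {0} or {1},
-- so the relation says exactly that w ≡ t (mod 2); then (w − t)(w − t − 2) ≡ 0 (mod 8), that is
-- w² + t(t + 2) ≡ 2(t + 1)w (mod 8) in every cell.  Summing over the cells, every term is known: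
-- Σ w² = k(k + 1)λ² by orthogonality, the sums of w weighted by [i ∈ X₁] or [j ∈ X₂] come from the
-- row and column counts, and the t-terms from |X₁| and |X₂|.  This gives a congruence modulo 8
-- between polynomials in k, λ, |X₁|, |X₂| and c, which for odd λ and k ≡ 1 or 5 (mod 8) determines
-- |X₁||X₂| modulo 4; checking that is a finite computation on residues modulo 8.
module Submission where

open import Defs
open import Data.Bool using (Bool; true; false; _∧_)
open import Data.Fin using (Fin; zero; suc)
open import Data.Fin.Patterns using (0F; 1F; 2F; 3F; 4F)
open import Data.Fin.Properties using () renaming (_≟_ to _≟ᶠ_)
open import Data.Nat using (ℕ; zero; suc; _+_; _*_; _%_; _<_; NonZero)
open import Data.Nat.DivMod using (%-distribˡ-+; %-distribˡ-*; m%n%n≡m%n; m%n<n; m∣n⇒o%n%m≡o%m; m*n%n≡0)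
open import Data.Nat.Divisibility using (divides)
open import Data.Nat.Properties
  using (+-*-semiring; _≟_; allUpTo?; +-identityʳ; *-identityˡ; *-comm; *-distribʳ-+)
open import Data.Nat.Tactic.RingSolver using (solve-∀)
open import Algebra.Properties.Semiring.Sum +-*-semiring
  using (sum; sum-cong-≗; sum-replicate-zero; ∑-distrib-+; ∑-comm; *-distribˡ-sum; *-distribʳ-sum)
open import Data.Unit using (tt)
open import Data.Product using (_×_; _,_; proj₁; proj₂)
open import Data.Vec.Functional using (Vector; []; _∷_)
open import Relation.Nullary.Decidable using (Dec; does; yes; no; toWitness; _→-dec_)
open import Relation.Binary.PropositionalEquality
  using (_≡_; _≢_; refl; sym; trans; cong; cong₂; module ≡-Reasoning)
open ≡-Reasoning

sumFin≡sum : ∀ {n} (f : Fin n → ℕ) → sumFin f ≡ sum f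
sumFin≡sum {zero}  f = refl
sumFin≡sum {suc n} f = cong (f zero +_) (sumFin≡sum (λ i → f (suc i)))

sum-const : ∀ n m → sum {n} (λ _ → m) ≡ n * m
sum-const zero    m = refl
sum-const (suc n) m = cong (m +_) (sum-const n m)

sum-*-sum : ∀ {m n} (u : Vector ℕ m) (v : Vector ℕ n) →
            sum u * sum v ≡ sum (λ s → sum (λ t → u s * v t))
sum-*-sum u v = begin
  sum u * sum v                       ≡⟨ *-distribʳ-sum (sum v) u ⟩
  sum (λ s → u s * sum v)             ≡⟨ sum-cong-≗ (λ s → *-distribˡ-sum (u s) v) ⟩
  sum (λ s → sum (λ t → u s * v t))   ∎

sum-indicator-≟ : ∀ {n} (s : Fin n) → sum (λ t → toℕ (does (s ≟ᶠ t))) ≡ 1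
sum-indicator-≟ {suc n} zero    = cong suc (sum-replicate-zero n)
sum-indicator-≟ {suc n} (suc s) = sum-indicator-≟ s

∑∑ : ∀ {m n} → (Fin m → Fin n → ℕ) → ℕ
∑∑ f = sum (λ i → sum (f i))

∑∑-rows : ∀ {m n} (u : Vector ℕ m) {g : Fin m → Fin n → ℕ} {r : ℕ} → (∀ i → sum (g i) ≡ r) →
          ∑∑ (λ i j → u i * g i j) ≡ sum u * r
∑∑-rows u {g} {r} rows = begin
  sum (λ i → sum (λ j → u i * g i j)) ≡⟨ sum-cong-≗ (λ i → *-distribˡ-sum (u i) (g i)) ⟨
  sum (λ i → u i * sum (g i))          ≡⟨ sum-cong-≗ (λ i → cong (u i *_) (rows i)) ⟩
  sum (λ i → u i * r)                  ≡⟨ *-distribʳ-sum r u ⟨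
  sum u * r                            ∎

module _ {m n : ℕ} where

  ∑∑-cong : {f g : Fin m → Fin n → ℕ} → (∀ i j → f i j ≡ g i j) → ∑∑ f ≡ ∑∑ g
  ∑∑-cong e = sum-cong-≗ (λ i → sum-cong-≗ (e i))

  ∑∑-+ : (f g : Fin m → Fin n → ℕ) → ∑∑ (λ i j → f i j + g i j) ≡ ∑∑ f + ∑∑ g
  ∑∑-+ f g = begin
    ∑∑ (λ i j → f i j + g i j)             ≡⟨ sum-cong-≗ (λ i → ∑-distrib-+ (f i) (g i)) ⟩
    sum (λ i → sum (f i) + sum (g i))      ≡⟨ ∑-distrib-+ (λ i → sum (f i)) (λ i → sum (g i)) ⟩
    ∑∑ f + ∑∑ g                            ∎

  ∑∑-*ˡ : ∀ d (f : Fin m → Fin n → ℕ) → ∑∑ (λ i j → d * f i j) ≡ d * ∑∑ f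
  ∑∑-*ˡ d f = begin
    ∑∑ (λ i j → d * f i j)        ≡⟨ sum-cong-≗ (λ i → *-distribˡ-sum d (f i)) ⟨
    sum (λ i → d * sum (f i))     ≡⟨ *-distribˡ-sum d (λ i → sum (f i)) ⟨
    d * ∑∑ f                      ∎

  ∑∑-const : ∀ d → ∑∑ {m} {n} (λ _ _ → d) ≡ m * (n * d)
  ∑∑-const d = begin
    ∑∑ {m} {n} (λ _ _ → d)   ≡⟨ sum-cong-≗ {m} (λ _ → sum-const n d) ⟩
    sum {m} (λ _ → n * d)    ≡⟨ sum-const m (n * d) ⟩
    m * (n * d)              ∎

  ∑∑-row : (u : Vector ℕ m) → ∑∑ {m} {n} (λ i _ → u i) ≡ n * sum u
  ∑∑-row u = begin
    ∑∑ {m} {n} (λ i _ → u i)   ≡⟨ sum-cong-≗ (λ i → sum-const n (u i)) ⟩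
    sum (λ i → n * u i)        ≡⟨ *-distribˡ-sum n u ⟨
    n * sum u                  ∎

  ∑∑-col : (v : Vector ℕ n) → ∑∑ {m} {n} (λ _ j → v j) ≡ m * sum v
  ∑∑-col v = sum-const m (sum v)

  ∑∑-cols : (v : Vector ℕ n) {g : Fin m → Fin n → ℕ} {r : ℕ} → (∀ j → sum (λ i → g i j) ≡ r) →
            ∑∑ (λ i j → v j * g i j) ≡ sum v * r
  ∑∑-cols v {g} cols = trans (∑-comm (λ i j → v j * g i j)) (∑∑-rows v {λ j i → g i j} cols)

  ∑∑-sum : ∀ {k} (g : Fin k → Fin m → Fin n → ℕ) →
           ∑∑ (λ i j → sum (λ s → g s i j)) ≡ sum (λ s → ∑∑ (g s))
  ∑∑-sum g = begin
    ∑∑ (λ i j → sum (λ s → g s i j))        ≡⟨ sum-cong-≗ (λ i → ∑-comm (λ j s → g s i j)) ⟩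
    sum (λ i → sum (λ s → sum (g s i)))     ≡⟨ ∑-comm (λ i s → sum (g s i)) ⟩
    sum (λ s → ∑∑ (g s))                    ∎

module _ {m : ℕ} .{{_ : NonZero m}} where

  +-cong-% : ∀ {a a′ b b′} → a % m ≡ a′ % m → b % m ≡ b′ % m → (a + b) % m ≡ (a′ + b′) % m
  +-cong-% {a} {a′} {b} {b′} p q = begin
    (a + b) % m           ≡⟨ %-distribˡ-+ a b m ⟩
    (a % m + b % m) % m   ≡⟨ cong₂ (λ u v → (u + v) % m) p q ⟩
    (a′ % m + b′ % m) % m ≡⟨ %-distribˡ-+ a′ b′ m ⟨
    (a′ + b′) % m         ∎

  *-cong-% : ∀ {a a′ b b′} → a % m ≡ a′ % m → b % m ≡ b′ % m → (a * b) % m ≡ (a′ * b′) % m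
  *-cong-% {a} {a′} {b} {b′} p q = begin
    (a * b) % m               ≡⟨ %-distribˡ-* a b m ⟩
    (a % m * (b % m)) % m     ≡⟨ cong₂ (λ u v → (u * v) % m) p q ⟩
    (a′ % m * (b′ % m)) % m   ≡⟨ %-distribˡ-* a′ b′ m ⟨
    (a′ * b′) % m             ∎

  sum-cong-% : ∀ {n} {f g : Vector ℕ n} → (∀ i → f i % m ≡ g i % m) → sum f % m ≡ sum g % m
  sum-cong-% {zero}  e = refl
  sum-cong-% {suc n} e = +-cong-% (e zero) (sum-cong-% (λ i → e (suc i)))

  ∑∑-cong-% : ∀ {n₁ n₂} {f g : Fin n₁ → Fin n₂ → ℕ} →
              (∀ i j → f i j % m ≡ g i j % m) → ∑∑ f % m ≡ ∑∑ g % m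
  ∑∑-cong-% e = sum-cong-% (λ i → sum-cong-% (e i))

%8%2 : ∀ a → a % 8 % 2 ≡ a % 2
%8%2 a = m∣n⇒o%n%m≡o%m 2 8 a (divides 4 refl)

%8%4 : ∀ a → a % 8 % 4 ≡ a % 4
%8%4 a = m∣n⇒o%n%m≡o%m 4 8 a (divides 2 refl)

even⇒%2≡0 : ∀ {a} → Even a → a % 2 ≡ 0
even⇒%2≡0 (q , refl) = trans (cong (λ z → (q + z) % 2) (sym (+-identityʳ q)))
                             (trans (cong (_% 2) (*-comm 2 q)) (m*n%n≡0 q 2))

-- Whether two polynomials are congruent modulo m at a point only depends on the residues of its
-- coordinates, so such congruences can be decided by a finite search.
infixl 6 _:+_
infixl 7 _:*_

data Poly (v : ℕ) : Set where
  var  : Fin v → Poly v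
  con  : ℕ → Poly v
  _:+_ : Poly v → Poly v → Poly v
  _:*_ : Poly v → Poly v → Poly v

⟦_⟧ : ∀ {v} → Poly v → Vector ℕ v → ℕ
⟦ var i ⟧  ρ = ρ i
⟦ con a ⟧  ρ = a
⟦ p :+ q ⟧ ρ = ⟦ p ⟧ ρ + ⟦ q ⟧ ρ
⟦ p :* q ⟧ ρ = ⟦ p ⟧ ρ * ⟦ q ⟧ ρ

⟦⟧-cong-% : ∀ {v} m .{{_ : NonZero m}} (p : Poly v) {ρ σ : Vector ℕ v} →
            (∀ i → ρ i % m ≡ σ i % m) → ⟦ p ⟧ ρ % m ≡ ⟦ p ⟧ σ % m
⟦⟧-cong-% m (var i)  e = e i
⟦⟧-cong-% m (con a)  e = refl
⟦⟧-cong-% m (p :+ q) e = +-cong-% (⟦⟧-cong-% m p e) (⟦⟧-cong-% m q e)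
⟦⟧-cong-% m (p :* q) e = *-cong-% (⟦⟧-cong-% m p e) (⟦⟧-cong-% m q e)

⟦⟧-% : ∀ {v} m .{{_ : NonZero m}} (p : Poly v) (ρ : Vector ℕ v) →
       ⟦ p ⟧ ρ % m ≡ ⟦ p ⟧ (λ i → ρ i % m) % m
⟦⟧-% m p ρ = ⟦⟧-cong-% m p (λ i → sym (m%n%n≡m%n (ρ i) m))

square-congruence : ∀ w t → (w + t) % 2 ≡ 0 → (w * w + t * (t + 2)) % 8 ≡ (2 * ((t + 1) * w)) % 8
square-congruence w t w+t-even = begin
  ⟦ L ⟧ ρ % 8                   ≡⟨ ⟦⟧-% 8 L ρ ⟩
  ⟦ L ⟧ (λ i → ρ i % 8) % 8     ≡⟨ residues (m%n<n w 8) (m%n<n t 8) w₈+t₈-even ⟩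
  ⟦ R ⟧ (λ i → ρ i % 8) % 8     ≡⟨ ⟦⟧-% 8 R ρ ⟨
  ⟦ R ⟧ ρ % 8                   ∎
  where
  ρ : Vector ℕ 2
  ρ = w ∷ t ∷ []

  L R : Poly 2
  L = var 0F :* var 0F :+ var 1F :* (var 1F :+ con 2)
  R = con 2 :* ((var 1F :+ con 1) :* var 0F)

  residues : ∀ {w} → w < 8 → ∀ {t} → t < 8 → (w + t) % 2 ≡ 0 →
             ⟦ L ⟧ (w ∷ t ∷ []) % 8 ≡ ⟦ R ⟧ (w ∷ t ∷ []) % 8
  residues = toWitness {a? = allUpTo? (λ w → allUpTo? (λ t →
    ((w + t) % 2 ≟ 0) →-dec (⟦ L ⟧ (w ∷ t ∷ []) % 8 ≟ ⟦ R ⟧ (w ∷ t ∷ []) % 8)) 8) 8} tt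

  w₈+t₈-even : (w % 8 + t % 8) % 2 ≡ 0
  w₈+t₈-even = trans (+-cong-% {a = w % 8} {w} {t % 8} {t} (%8%2 w) (%8%2 t)) w+t-even

𝒌 𝒍 𝒙 𝒚 𝒄 : Poly 5
𝒌 = var 0F
𝒍 = var 1F
𝒙 = var 2F
𝒚 = var 3F
𝒄 = var 4F

counting-lhs counting-rhs : Poly 5
counting-lhs = 𝒌 :* (𝒌 :* (𝒍 :* 𝒍) :+ 𝒍 :* 𝒍)
             :+ ((con 3 :+ con 2 :* 𝒄) :* ((𝒍 :+ 𝒍) :* 𝒙 :+ (𝒍 :+ 𝒍) :* 𝒚)
                 :+ con 2 :* (𝒙 :* 𝒚) :+ (𝒍 :+ 𝒍) :* ((𝒍 :+ 𝒍) :* (𝒄 :* (𝒄 :+ con 2))))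
counting-rhs = con 2 :* (𝒙 :* (𝒌 :* 𝒍) :+ 𝒚 :* (𝒌 :* 𝒍))
             :+ con 2 :* ((𝒄 :+ con 1) :* ((𝒍 :+ 𝒍) :* (𝒌 :* 𝒍)))

CountingCongruence : ℕ → ℕ → ℕ → ℕ → ℕ → Set
CountingCongruence k l x y c =
  ⟦ counting-lhs ⟧ (k ∷ l ∷ x ∷ y ∷ c ∷ []) % 8 ≡ ⟦ counting-rhs ⟧ (k ∷ l ∷ x ∷ y ∷ c ∷ []) % 8

ForcedOnResidues : ℕ → ℕ → Set
ForcedOnResidues κ τ = ∀ {l} → l < 8 → ∀ {x} → x < 8 → ∀ {y} → y < 8 → ∀ {c} → c < 8 →
  l % 2 ≡ 1 → CountingCongruence κ l x y c → (x * y) % 4 ≡ τ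

forcedOnResidues? : ∀ κ τ → Dec (ForcedOnResidues κ τ)
forcedOnResidues? κ τ = allUpTo? (λ l → allUpTo? (λ x → allUpTo? (λ y → allUpTo? (λ c →
  (l % 2 ≟ 1) →-dec (congruence? l x y c →-dec ((x * y) % 4 ≟ τ))) 8) 8) 8) 8
  where
  congruence? : ∀ l x y c → Dec (CountingCongruence κ l x y c)
  congruence? l x y c =
    ⟦ counting-lhs ⟧ (κ ∷ l ∷ x ∷ y ∷ c ∷ []) % 8 ≟ ⟦ counting-rhs ⟧ (κ ∷ l ∷ x ∷ y ∷ c ∷ []) % 8

counting-congruence⇒xy%4 : ∀ κ τ → ForcedOnResidues κ τ →
                           ∀ {k l x y c} → k % 8 ≡ κ % 8 → l % 2 ≡ 1 →
                           CountingCongruence k l x y c → (x * y) % 4 ≡ τ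
counting-congruence⇒xy%4 κ τ claim {k} {l} {x} {y} {c} k≡κ l-odd congruence = begin
  (x * y) % 4             ≡⟨ *-cong-% {a = x} {x % 8} {y} {y % 8} (sym (%8%4 x)) (sym (%8%4 y)) ⟩
  (x % 8 * (y % 8)) % 4   ≡⟨ claim (m%n<n l 8) (m%n<n x 8) (m%n<n y 8) (m%n<n c 8) l₈-odd congruence₈ ⟩
  τ                       ∎
  where
  ρ : Vector ℕ 4
  ρ = l ∷ x ∷ y ∷ c ∷ []

  agree : ∀ i → (k ∷ ρ) i % 8 ≡ (κ ∷ λ i → ρ i % 8) i % 8
  agree zero    = k≡κ
  agree (suc i) = sym (m%n%n≡m%n (ρ i) 8)

  l₈-odd : l % 8 % 2 ≡ 1
  l₈-odd = trans (%8%2 l) l-odd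

  congruence₈ : CountingCongruence κ (l % 8) (x % 8) (y % 8) (c % 8)
  congruence₈ = trans (sym (⟦⟧-cong-% 8 counting-lhs {k ∷ ρ} {κ ∷ λ i → ρ i % 8} agree))
                      (trans congruence (⟦⟧-cong-% 8 counting-rhs {k ∷ ρ} {κ ∷ λ i → ρ i % 8} agree))

toℕ-idem : ∀ β → toℕ β * toℕ β ≡ toℕ β
toℕ-idem false = refl
toℕ-idem true  = refl

toℕ-*-∧ : ∀ β γ → toℕ β * toℕ γ ≡ toℕ ((β == true) ∧ (γ == true))
toℕ-*-∧ false γ     = refl
toℕ-*-∧ true  false = refl
toℕ-*-∧ true  true  = refl

nonTrivial-parity : {X : Bool → Bool} → NonTrivial X →
                    ∀ β → toℕ (X β) % 2 ≡ (toℕ β + toℕ (X false)) % 2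
nonTrivial-parity _                         false = refl
nonTrivial-parity (true  , false , X1 , X0) true rewrite X1 | X0 = refl
nonTrivial-parity (false , true  , X0 , X1) true rewrite X1 | X0 = refl
nonTrivial-parity (true  , true  , X1 , X1′) true with trans (sym X1) X1′
... | ()
nonTrivial-parity (false , false , X0 , X0′) true with trans (sym X0) X0′
... | ()

count2≡∑∑ : ∀ {n} (p : Fin n → Fin n → Bool) → count2 p ≡ ∑∑ (λ i j → toℕ (p i j))
count2≡∑∑ p = begin
  sumFin (λ i → count (p i))           ≡⟨ sumFin≡sum (λ i → count (p i)) ⟩
  sum (λ i → count (p i))              ≡⟨ sum-cong-≗ (λ i → sumFin≡sum (λ j → toℕ (p i j))) ⟩
  ∑∑ (λ i j → toℕ (p i j))             ∎

bits-quadratic : ∀ {u v} c → u * u ≡ u → v * v ≡ v →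
                 (u + v + c) * (u + v + c + 2) ≡ (3 + 2 * c) * (u + v) + 2 * (u * v) + c * (c + 2)
bits-quadratic {u} {v} c uu vv = begin
  (u + v + c) * (u + v + c + 2)          ≡⟨ expand u v c ⟩
  (u * u + v * v) + rest                 ≡⟨ cong (_+ rest) (cong₂ _+_ uu vv) ⟩
  (u + v) + rest                         ≡⟨ collect u v c ⟩
  (3 + 2 * c) * (u + v) + 2 * (u * v) + c * (c + 2) ∎
  where
  rest : ℕ
  rest = (2 + 2 * c) * (u + v) + 2 * (u * v) + c * (c + 2)
  expand : ∀ u v c → (u + v + c) * (u + v + c + 2) ≡
                     (u * u + v * v) + ((2 + 2 * c) * (u + v) + 2 * (u * v) + c * (c + 2))
  expand = solve-∀

  collect : ∀ u v c → (u + v) + ((2 + 2 * c) * (u + v) + 2 * (u * v) + c * (c + 2)) ≡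
                      (3 + 2 * c) * (u + v) + 2 * (u * v) + c * (c + 2)
  collect = solve-∀

module Counting {l k : ℕ} {F : Fin k → Square (l + l)} (mofs : IsMOFS l k F)
  {X₁ X₂ : Fin (l + l) → Bool} {Xs : Fin k → Bool → Bool}
  (rel : IsRelation F X₁ X₂ Xs) (nonTrivial : ∀ s → NonTrivial (Xs s)) where

  n : ℕ
  n = l + l

  f : Fin k → Fin n → Fin n → ℕ
  f s i j = toℕ (F s i j)

  w : Fin n → Fin n → ℕ
  w i j = sum (λ s → f s i j)

  a b : Fin n → ℕ
  a i = toℕ (X₁ i)
  b j = toℕ (X₂ j)

  x y c : ℕ
  x = count X₁
  y = count X₂
  c = sum (λ s → toℕ (Xs s false))

  row-ones : ∀ s i → sum (f s i) ≡ l
  row-ones s i = trans (sym (sumFin≡sum (f s i))) (proj₁ (proj₁ (proj₁ mofs s) i))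

  col-ones : ∀ s j → sum (λ i → f s i j) ≡ l
  col-ones s j = trans (sym (sumFin≡sum (λ i → f s i j))) (proj₁ (proj₂ (proj₁ mofs s) j))

  row-w : ∀ i → sum (w i) ≡ k * l
  row-w i = begin
    sum (w i)                 ≡⟨ ∑-comm (λ j s → f s i j) ⟩
    sum (λ s → sum (f s i))   ≡⟨ sum-cong-≗ (λ s → row-ones s i) ⟩
    sum {k} (λ _ → l)         ≡⟨ sum-const k l ⟩
    k * l                     ∎

  col-w : ∀ j → sum (λ i → w i j) ≡ k * l
  col-w j = begin
    sum (λ i → w i j)                 ≡⟨ ∑-comm (λ i s → f s i j) ⟩
    sum (λ s → sum (λ i → f s i j))   ≡⟨ sum-cong-≗ (λ s → col-ones s j) ⟩
    sum {k} (λ _ → l)                 ≡⟨ sum-const k l ⟩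
    k * l                             ∎

  common-ones : Fin k → Fin k → ℕ
  common-ones s t = ∑∑ (λ i j → f s i j * f t i j)

  common-ones-≡ : ∀ s → common-ones s s ≡ l * l + l * l
  common-ones-≡ s = begin
    common-ones s s     ≡⟨ ∑∑-cong (λ i j → toℕ-idem (F s i j)) ⟩
    ∑∑ (f s)            ≡⟨ sum-cong-≗ (row-ones s) ⟩
    sum {n} (λ _ → l)   ≡⟨ sum-const n l ⟩
    n * l               ≡⟨ *-distribʳ-+ l l l ⟩
    l * l + l * l       ∎

  common-ones-≢ : ∀ {s t} → s ≢ t → common-ones s t ≡ l * l
  common-ones-≢ {s} {t} s≢t = begin
    common-ones s t
      ≡⟨ ∑∑-cong (λ i j → toℕ-*-∧ (F s i j) (F t i j)) ⟩
    ∑∑ (λ i j → toℕ (both i j))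
      ≡⟨ count2≡∑∑ both ⟨
    count2 both
      ≡⟨ proj₂ mofs s t s≢t true true ⟩
    l * l
      ∎
    where
    both : Fin n → Fin n → Bool
    both i j = (F s i j == true) ∧ (F t i j == true)

  common-ones-δ : ∀ s t → common-ones s t ≡ l * l + toℕ (does (s ≟ᶠ t)) * (l * l)
  common-ones-δ s t with s ≟ᶠ t
  ... | yes refl = trans (common-ones-≡ s) (cong (l * l +_) (sym (*-identityˡ (l * l))))
  ... | no s≢t   = trans (common-ones-≢ s≢t) (sym (+-identityʳ (l * l)))

  common-ones-row : ∀ s → sum (common-ones s) ≡ k * (l * l) + l * l
  common-ones-row s = begin
    sum (common-ones s)
      ≡⟨ sum-cong-≗ (common-ones-δ s) ⟩
    sum (λ t → l * l + toℕ (does (s ≟ᶠ t)) * (l * l))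
      ≡⟨ ∑-distrib-+ (λ _ → l * l) (λ t → toℕ (does (s ≟ᶠ t)) * (l * l)) ⟩
    sum {k} (λ _ → l * l) + sum (λ t → toℕ (does (s ≟ᶠ t)) * (l * l))
      ≡⟨ cong₂ _+_ (sum-const k (l * l)) (sym (*-distribʳ-sum (l * l) (λ t → toℕ (does (s ≟ᶠ t))))) ⟩
    k * (l * l) + sum (λ t → toℕ (does (s ≟ᶠ t))) * (l * l)
      ≡⟨ cong (λ z → k * (l * l) + z * (l * l)) (sum-indicator-≟ s) ⟩
    k * (l * l) + 1 * (l * l)
      ≡⟨ cong (k * (l * l) +_) (*-identityˡ (l * l)) ⟩
    k * (l * l) + l * l
      ∎

  ∑∑-w² : ∑∑ (λ i j → w i j * w i j) ≡ k * (k * (l * l) + l * l)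
  ∑∑-w² = begin
    ∑∑ (λ i j → w i j * w i j)
      ≡⟨ ∑∑-cong (λ i j → sum-*-sum (λ s → f s i j) (λ t → f t i j)) ⟩
    ∑∑ (λ i j → sum (λ s → sum (λ t → f s i j * f t i j)))
      ≡⟨ ∑∑-sum (λ s i j → sum (λ t → f s i j * f t i j)) ⟩
    sum (λ s → ∑∑ (λ i j → sum (λ t → f s i j * f t i j)))
      ≡⟨ sum-cong-≗ (λ s → ∑∑-sum (λ t i j → f s i j * f t i j)) ⟩
    sum (λ s → sum (common-ones s))
      ≡⟨ sum-cong-≗ common-ones-row ⟩
    sum {k} (λ _ → k * (l * l) + l * l)
      ≡⟨ sum-const k _ ⟩
    k * (k * (l * l) + l * l)
      ∎

  t : Fin n → Fin n → ℕ
  t i j = a i + b j + c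

  w+t-even : ∀ i j → (w i j + t i j) % 2 ≡ 0
  w+t-even i j = begin
    (w i j + (a i + b j + c)) % 2
      ≡⟨ cong (_% 2) (rearrange (w i j) (a i) (b j) c) ⟩
    (a i + b j + (w i j + c)) % 2
      ≡⟨ +-cong-% {a = a i + b j} {a i + b j} {sum X[F]} {w i j + c} refl X-parity ⟨
    (a i + b j + sum X[F]) % 2
      ≡⟨ cong (λ z → (a i + b j + z) % 2) (sumFin≡sum X[F]) ⟨
    (a i + b j + sumFin X[F]) % 2
      ≡⟨ even⇒%2≡0 (rel i j) ⟩
    0
      ∎
    where
    X[F] : Fin k → ℕ
    X[F] s = toℕ (Xs s (F s i j))

    X-parity : sum X[F] % 2 ≡ (w i j + c) % 2
    X-parity = trans (sum-cong-% (λ s → nonTrivial-parity (nonTrivial s) (F s i j)))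
                     (cong (_% 2) (∑-distrib-+ (λ s → f s i j) (λ s → toℕ (Xs s false))))

    rearrange : ∀ w a b c → w + (a + b + c) ≡ a + b + (w + c)
    rearrange = solve-∀

  t-expansion : Fin n → Fin n → ℕ
  t-expansion i j = (3 + 2 * c) * (a i + b j) + 2 * (a i * b j) + c * (c + 2)

  cell-lhs cell-rhs : Fin n → Fin n → ℕ
  cell-lhs i j = w i j * w i j + t-expansion i j
  cell-rhs i j = 2 * (a i * w i j + b j * w i j) + 2 * ((c + 1) * w i j)

  cell-congruence : ∀ i j → cell-lhs i j % 8 ≡ cell-rhs i j % 8
  cell-congruence i j = begin
    cell-lhs i j % 8                           ≡⟨ cong (λ z → (w i j * w i j + z) % 8) t-quadratic ⟨
    (w i j * w i j + t i j * (t i j + 2)) % 8  ≡⟨ square-congruence (w i j) (t i j) (w+t-even i j) ⟩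
    (2 * ((t i j + 1) * w i j)) % 8            ≡⟨ cong (_% 8) (split (a i) (b j) c (w i j)) ⟩
    cell-rhs i j % 8                           ∎
    where
    t-quadratic : t i j * (t i j + 2) ≡ t-expansion i j
    t-quadratic = bits-quadratic c (toℕ-idem (X₁ i)) (toℕ-idem (X₂ j))

    split : ∀ a b c w → 2 * ((a + b + c + 1) * w) ≡ 2 * (a * w + b * w) + 2 * ((c + 1) * w)
    split = solve-∀

  ρ : Vector ℕ 5
  ρ = k ∷ l ∷ x ∷ y ∷ c ∷ []

  sum-a : sum a ≡ x
  sum-a = sym (sumFin≡sum a)

  sum-b : sum b ≡ y
  sum-b = sym (sumFin≡sum b)

  ∑∑-t-expansion : ∑∑ t-expansion ≡ (3 + 2 * c) * (n * x + n * y) + 2 * (x * y) + n * (n * (c * (c + 2)))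
  ∑∑-t-expansion = begin
    ∑∑ t-expansion
      ≡⟨ ∑∑-+ (λ i j → (3 + 2 * c) * (a i + b j) + 2 * (a i * b j)) (λ _ _ → c * (c + 2)) ⟩
    ∑∑ (λ i j → (3 + 2 * c) * (a i + b j) + 2 * (a i * b j)) + ∑∑ {n} {n} (λ _ _ → c * (c + 2))
      ≡⟨ cong₂ _+_ (∑∑-+ (λ i j → (3 + 2 * c) * (a i + b j)) (λ i j → 2 * (a i * b j)))
                   (∑∑-const {n} {n} (c * (c + 2))) ⟩
    ∑∑ (λ i j → (3 + 2 * c) * (a i + b j)) + ∑∑ (λ i j → 2 * (a i * b j)) + n * (n * (c * (c + 2)))
      ≡⟨ cong₂ (λ p q → p + q + n * (n * (c * (c + 2))))
               (trans (∑∑-*ˡ (3 + 2 * c) (λ i j → a i + b j)) (cong ((3 + 2 * c) *_) ∑∑-a+b))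
               (trans (∑∑-*ˡ 2 (λ i j → a i * b j)) (cong (2 *_) ∑∑-ab)) ⟩
    (3 + 2 * c) * (n * x + n * y) + 2 * (x * y) + n * (n * (c * (c + 2)))
      ∎
    where
    ∑∑-a+b : ∑∑ (λ i j → a i + b j) ≡ n * x + n * y
    ∑∑-a+b = trans (∑∑-+ (λ i _ → a i) (λ _ j → b j))
                   (cong₂ _+_ (trans (∑∑-row {n} {n} a) (cong (n *_) sum-a))
                              (trans (∑∑-col {n} {n} b) (cong (n *_) sum-b)))

    ∑∑-ab : ∑∑ (λ i j → a i * b j) ≡ x * y
    ∑∑-ab = trans (∑∑-rows a {λ _ j → b j} (λ _ → refl)) (cong₂ _*_ sum-a sum-b)

  ∑∑-cell-lhs : ∑∑ cell-lhs ≡ ⟦ counting-lhs ⟧ ρ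
  ∑∑-cell-lhs = trans (∑∑-+ (λ i j → w i j * w i j) t-expansion)
                      (cong₂ _+_ ∑∑-w² ∑∑-t-expansion)

  ∑∑-cell-rhs : ∑∑ cell-rhs ≡ ⟦ counting-rhs ⟧ ρ
  ∑∑-cell-rhs = begin
    ∑∑ cell-rhs
      ≡⟨ ∑∑-+ (λ i j → 2 * (a i * w i j + b j * w i j)) (λ i j → 2 * ((c + 1) * w i j)) ⟩
    ∑∑ (λ i j → 2 * (a i * w i j + b j * w i j)) + ∑∑ (λ i j → 2 * ((c + 1) * w i j))
      ≡⟨ cong₂ _+_ (∑∑-*ˡ 2 (λ i j → a i * w i j + b j * w i j))
                   (∑∑-*ˡ 2 (λ i j → (c + 1) * w i j)) ⟩
    2 * ∑∑ (λ i j → a i * w i j + b j * w i j) + 2 * ∑∑ (λ i j → (c + 1) * w i j)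
      ≡⟨ cong₂ (λ p q → 2 * p + 2 * q)
               ∑∑-aw+bw (trans (∑∑-*ˡ (c + 1) w) (cong ((c + 1) *_) ∑∑-w)) ⟩
    2 * (x * (k * l) + y * (k * l)) + 2 * ((c + 1) * (n * (k * l)))
      ∎
    where
    ∑∑-aw+bw : ∑∑ (λ i j → a i * w i j + b j * w i j) ≡ x * (k * l) + y * (k * l)
    ∑∑-aw+bw = trans (∑∑-+ (λ i j → a i * w i j) (λ i j → b j * w i j))
                     (cong₂ _+_ (trans (∑∑-rows a {w} row-w) (cong (_* (k * l)) sum-a))
                                (trans (∑∑-cols b {w} col-w) (cong (_* (k * l)) sum-b)))

    ∑∑-w : ∑∑ w ≡ n * (k * l)
    ∑∑-w = trans (sum-cong-≗ row-w) (sum-const n (k * l))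

  counting-congruence : CountingCongruence k l x y c
  counting-congruence = begin
    ⟦ counting-lhs ⟧ ρ % 8   ≡⟨ cong (_% 8) ∑∑-cell-lhs ⟨
    ∑∑ cell-lhs % 8          ≡⟨ ∑∑-cong-% cell-congruence ⟩
    ∑∑ cell-rhs % 8          ≡⟨ cong (_% 8) ∑∑-cell-rhs ⟩
    ⟦ counting-rhs ⟧ ρ % 8   ∎

forced-k≡1 : ForcedOnResidues 1 1
forced-k≡1 = toWitness {a? = forcedOnResidues? 1 1} tt

forced-k≡5 : ForcedOnResidues 5 3
forced-k≡5 = toWitness {a? = forcedOnResidues? 5 3} tt

theorem2p5 : (λ' k : ℕ) → λ' % 2 ≡ 1 → 1 Data.Nat.≤ k →
    (F : Fin k → Square (λ' + λ')) → IsMOFS λ' k F →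
    (X₁ X₂ : Fin (λ' + λ') → Bool) → (Xs : Fin k → Bool → Bool) →
    IsRelation F X₁ X₂ Xs → IsFull X₁ X₂ Xs →
    (k % 8 ≡ 1 → (count X₁ * count X₂) % 4 ≡ 1) ×
    (k % 8 ≡ 5 → (count X₁ * count X₂) % 4 ≡ 3)
theorem2p5 l k l-odd _ F mofs X₁ X₂ Xs rel full =
  (λ k≡1 → counting-congruence⇒xy%4 1 1 forced-k≡1 {k} {l} {x} {y} {c} k≡1 l-odd counting-congruence) ,
  (λ k≡5 → counting-congruence⇒xy%4 5 3 forced-k≡5 {k} {l} {x} {y} {c} k≡5 l-odd counting-congruence)
  where open Counting mofs {X₁} {X₂} rel (proj₂ full)
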